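{- Let $V:\mathbb R^2\to\mathbb R^5$ be the Veronese map $V(x,y)=(x,y,x^2,xy,y^2)$. Let $p,q,r\in\mathbb R^2$ be non-collinear and let $P$ be the affine span of $V(p),V(q),V(r)$ (a $2$-flat in $\mathbb R^5$). Let $S\subseteq\mathbb R^2\setminus\{p,q,r\}$ be finite (so $V(S)$ is disjoint from $P$), and let $Q\subset\mathbb R^5$ be a $2$-flat disjoint from $P$ such that for every $x\in V(S)$ the intersection of $Q$ with the affine span of $P\cup\{x\}$ is a single point, denoted $\pi(x)$. Then the map $\pi:V(S)\to Q$ is injective on $V(S\setminus\Delta_{pqr})$, where $\Delta_{pqr}=\overline{pq}\cup\overline{pr}\cup\overline{qr}$ is the union of the three lines through pairs of $p,q,r$. Moreover, there are points $\alpha_1,\alpha_2,\alpha_3\in Q$ such that $\pi(V(s))=\alpha_1$ for every $s\in S\cap\overline{pq}$, $\pi(V(s))=\alpha_2$ for every $s\in S\cap\overline{pr}$, and $\pi(V(s))=\alpha_3$ for every $s\in S\cap\overline{qr}$.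
   Context: $\overline{ab}$ denotes the line through distinct points $a,b\in\mathbb R^2$. A $2$-flat is a $2$-dimensional affine subspace. -}

module Defs where

open import Level using (0ℓ)
open import Data.Nat using (ℕ)
open import Data.Fin using (Fin)
open import Data.Vec using (Vec; []; _∷_; zipWith; foldr; map)
open import Data.List using (List)
open import Data.List.Membership.Propositional using (_∈_)
open import Data.Product using (Σ; Σ-syntax; _×_; ∃; ∃-syntax; proj₁)
open import Data.Sum using (_⊎_)
open import Relation.Nullary using (¬_)
open import Relation.Binary.PropositionalEquality using (_≡_)
open import Relation.Binary.Structures using (IsStrictTotalOrder)
open import Algebra.Structures using (IsCommutativeRing)

-- The real numbers, axiomatised as a Dedekind-complete ordered field
-- (unique up to isomorphism, so quantifying over all models is the same
-- as speaking about ℝ).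

record RealField : Set₁ where
  infixl 6 _+_
  infixl 7 _*_
  infix  4 _<_
  field
    ℝ   : Set
    _+_ _*_ : ℝ → ℝ → ℝ
    -_  : ℝ → ℝ
    0r 1r : ℝ
    _<_ : ℝ → ℝ → Set
    isCommutativeRing : IsCommutativeRing _≡_ _+_ _*_ -_ 0r 1r
    0≢1 : ¬ (0r ≡ 1r)
    inverse : ∀ x → ¬ (x ≡ 0r) → Σ[ y ∈ ℝ ] (x * y ≡ 1r)
    isStrictTotalOrder : IsStrictTotalOrder _≡_ _<_
    +-mono-< : ∀ {x y} z → x < y → x + z < y + z
    *-pos : ∀ {x y} → 0r < x → 0r < y → 0r < x * y
    complete : (A : ℝ → Set) → (∃[ a ] A a) → (∃[ b ] (∀ a → A a → (a < b ⊎ a ≡ b))) →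
               ∃[ s ] ((∀ a → A a → (a < s ⊎ a ≡ s)) ×
                       (∀ b → (∀ a → A a → (a < b ⊎ a ≡ b)) → (s < b ⊎ s ≡ b)))

module Geometry (R : RealField) where
  open RealField R public

  infixl 6 _-_
  _-_ : ℝ → ℝ → ℝ
  x - y = x + (- y)

  Pt : ℕ → Set
  Pt n = Vec ℝ n

  _⊕_ : ∀ {n} → Pt n → Pt n → Pt n
  _⊕_ = zipWith _+_

  _⊖_ : ∀ {n} → Pt n → Pt n → Pt n
  _⊖_ = zipWith _-_

  _·_ : ∀ {n} → ℝ → Pt n → Pt n
  c · v = map (c *_) v

  origin : ∀ {n} → Pt n
  origin {n} = Data.Vec.replicate n 0r

  sumℝ : ∀ {k} → Vec ℝ k → ℝ
  sumℝ = foldr _ _+_ 0r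

  lincomb : ∀ {n k} → Vec ℝ k → Vec (Pt n) k → Pt n
  lincomb [] [] = origin
  lincomb (c ∷ cs) (p ∷ ps) = (c · p) ⊕ lincomb cs ps

  InAffSpan : ∀ {n k} → Vec (Pt n) k → Pt n → Set
  InAffSpan {k = k} ps x =
    Σ[ cs ∈ Vec ℝ k ] ((sumℝ cs ≡ 1r) × (x ≡ lincomb cs ps))

  AffIndep3 : ∀ {n} → Pt n → Pt n → Pt n → Set
  AffIndep3 a b c =
    ∀ s t → (s · (b ⊖ a)) ⊕ (t · (c ⊖ a)) ≡ origin → (s ≡ 0r) × (t ≡ 0r)

  -- a 2-flat in ℝⁿ, given as the affine span of three affinely
  -- independent points
  record TwoFlat (n : ℕ) : Set where
    constructor flat
    field
      a₀ a₁ a₂ : Pt n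
      indep : AffIndep3 a₀ a₁ a₂

  _∈F_ : ∀ {n} → Pt n → TwoFlat n → Set
  x ∈F flat a b c _ = InAffSpan (a ∷ b ∷ c ∷ []) x

  OnLine : ∀ {n} → Pt n → Pt n → Pt n → Set
  OnLine a b x = Σ[ t ∈ ℝ ] (x ≡ a ⊕ (t · (b ⊖ a)))

  InΔ : Pt 2 → Pt 2 → Pt 2 → Pt 2 → Set
  InΔ p q r x = OnLine p q x ⊎ OnLine p r x ⊎ OnLine q r x

  Veronese : Pt 2 → Pt 5
  Veronese (x ∷ y ∷ []) = x ∷ y ∷ x * x ∷ x * y ∷ y * y ∷ []

  InSpanPx : Pt 2 → Pt 2 → Pt 2 → Pt 5 → Pt 5 → Set
  InSpanPx p q r x z =
    InAffSpan (Veronese p ∷ Veronese q ∷ Veronese r ∷ x ∷ []) z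

  UniqueMeet : Pt 2 → Pt 2 → Pt 2 → TwoFlat 5 → Pt 5 → Set
  UniqueMeet p q r Q x =
    Σ[ y ∈ Pt 5 ] ((y ∈F Q × InSpanPx p q r x y) ×
                   (∀ z → z ∈F Q → InSpanPx p q r x z → z ≡ y))

  InP : Pt 2 → Pt 2 → Pt 2 → Pt 5 → Set
  InP p q r z = InAffSpan (Veronese p ∷ Veronese q ∷ Veronese r ∷ []) z

-- A polynomial of degree at most 2 on the plane is an affine function of the
-- Veronese image, so it vanishes at x once it vanishes at points whose Veronese
-- images span V(x).  If π(V s) = π(V s′), then V s′ lies in the span of P and
-- V s (otherwise the common image would lie in P ∩ Q), so the line pairs
-- pq ∪ rs and pr ∪ qs, being conics through p, q, r, s, contain s′; off Δ this
-- puts s′ on both rs and qs, hence s′ = s.  Conversely, the Veronese image of a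
-- line is a conic in a plane: the images of three distinct points of a line
-- span the images of all its points, so all points of S on one of the lines
-- pq, pr, qr have the same projection.

module Submission where

open import Defs
open import Algebra.Bundles using (CommutativeRing)
open import Algebra.Solver.Ring.AlmostCommutativeRing
  using (AlmostCommutativeRing; _-Raw-AlmostCommutative⟶_; fromCommutativeRing)
open import Data.Empty using (⊥-elim)
open import Data.Integer as ℤ using (ℤ; -[1+_]; sign; ∣_∣; _◃_) renaming (+_ to pos)
import Data.Integer.Properties as ℤ
open import Data.List using (List)
open import Data.List.Membership.Propositional using (_∈_; find; lose)
open import Data.List.Relation.Unary.Any using (any?)
open import Data.Maybe using (Maybe; just; nothing)
open import Data.Nat as ℕ using (zero; suc)
import Data.Nat.Properties as ℕ
open import Data.Product using (Σ-syntax; _×_; ∃-syntax; proj₁; proj₂; _,_)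
open import Data.Sign as Sign using (Sign)
open import Data.Sum using (_⊎_; inj₁; inj₂)
open import Data.Vec using (Vec; []; _∷_; _∷ʳ_; _++_; map; zipWith; initLast)
open import Data.Vec.Properties using (zipWith-assoc; zipWith-identityˡ; zipWith-identityʳ)
open import Data.Vec.Relation.Unary.All as All using (All; []; _∷_)
open import Data.Vec.Relation.Unary.All.Properties using (map⁺)
open import Relation.Binary.PropositionalEquality
open import Relation.Binary.Structures using (IsStrictTotalOrder)
open import Relation.Nullary using (¬_; Dec; yes; no)
open import Relation.Unary using (Decidable)

-- Algebra.Solver.Ring needs a coefficient ring with decidable equality;
-- the coefficients are integers, read in ℝ through the ring map ℤ → ℝ.
module RealRingSolver (R : RealField) where
  open RealField R

  commutativeRing : CommutativeRing _ _
  commutativeRing = record { isCommutativeRing = isCommutativeRing }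

  open CommutativeRing commutativeRing
    using (+-identityˡ; +-identityʳ; +-comm; -‿inverseʳ; semiring; ring; +-abelianGroup; +-commutativeSemigroup)
  open import Algebra.Properties.Semiring.Mult.TCOptimised semiring
    using (×-homo-+; ×1-homo-*; 1+×) renaming (_×_ to _×ℝ_)
  open import Algebra.Properties.Ring ring using (-‿distribˡ-*; -‿distribʳ-*; -‿involutive; -0#≈0#)
  open import Algebra.Properties.AbelianGroup +-abelianGroup using (⁻¹-∙-comm)
  open import Algebra.Properties.CommutativeSemigroup +-commutativeSemigroup using (interchange)
  open ≡-Reasoning

  ⟦_⟧ℤ : ℤ → ℝ
  ⟦ pos n ⟧ℤ = n ×ℝ 1r
  ⟦ -[1+ n ] ⟧ℤ = - (suc n ×ℝ 1r)

  private
    signed : Sign → ℝ → ℝ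
    signed Sign.+ x = x
    signed Sign.- x = - x

    ⟦◃⟧ : ∀ s n → ⟦ s ◃ n ⟧ℤ ≡ signed s (n ×ℝ 1r)
    ⟦◃⟧ Sign.- zero = sym -0#≈0#
    ⟦◃⟧ Sign.+ zero = refl
    ⟦◃⟧ Sign.- (suc n) = refl
    ⟦◃⟧ Sign.+ (suc n) = refl

    ⟦sign◃abs⟧ : ∀ i → ⟦ i ⟧ℤ ≡ signed (sign i) (∣ i ∣ ×ℝ 1r)
    ⟦sign◃abs⟧ (pos zero) = refl
    ⟦sign◃abs⟧ (pos (suc n)) = refl
    ⟦sign◃abs⟧ -[1+ n ] = refl

    signed-* : ∀ s t x y → signed (s Sign.* t) (x * y) ≡ signed s x * signed t y
    signed-* Sign.- Sign.- x y = begin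
      x * y         ≡⟨ sym (-‿involutive _) ⟩
      - - (x * y)   ≡⟨ cong -_ (-‿distribˡ-* x y) ⟩
      - (- x * y)   ≡⟨ -‿distribʳ-* _ _ ⟩
      - x * - y     ∎
    signed-* Sign.- Sign.+ x y = -‿distribˡ-* x y
    signed-* Sign.+ Sign.- x y = -‿distribʳ-* x y
    signed-* Sign.+ Sign.+ x y = refl

    *-homo : ∀ i j → ⟦ i ℤ.* j ⟧ℤ ≡ ⟦ i ⟧ℤ * ⟦ j ⟧ℤ
    *-homo i j = begin
      ⟦ i ℤ.* j ⟧ℤ
        ≡⟨ ⟦◃⟧ (sign i Sign.* sign j) (∣ i ∣ ℕ.* ∣ j ∣) ⟩
      signed (sign i Sign.* sign j) ((∣ i ∣ ℕ.* ∣ j ∣) ×ℝ 1r)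
        ≡⟨ cong (signed (sign i Sign.* sign j)) (×1-homo-* ∣ i ∣ ∣ j ∣) ⟩
      signed (sign i Sign.* sign j) ((∣ i ∣ ×ℝ 1r) * (∣ j ∣ ×ℝ 1r))
        ≡⟨ signed-* (sign i) (sign j) _ _ ⟩
      signed (sign i) (∣ i ∣ ×ℝ 1r) * signed (sign j) (∣ j ∣ ×ℝ 1r)
        ≡⟨ sym (cong₂ _*_ (⟦sign◃abs⟧ i) (⟦sign◃abs⟧ j)) ⟩
      ⟦ i ⟧ℤ * ⟦ j ⟧ℤ ∎

    ⟦⊖⟧ : ∀ m n → ⟦ m ℤ.⊖ n ⟧ℤ ≡ m ×ℝ 1r + - (n ×ℝ 1r)
    ⟦⊖⟧ zero zero = sym (trans (cong (0r +_) -0#≈0#) (+-identityʳ 0r))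
    ⟦⊖⟧ zero (suc n) = sym (+-identityˡ _)
    ⟦⊖⟧ (suc m) zero = sym (trans (cong (suc m ×ℝ 1r +_) -0#≈0#) (+-identityʳ _))
    ⟦⊖⟧ (suc m) (suc n) = begin
      ⟦ suc m ℤ.⊖ suc n ⟧ℤ             ≡⟨ cong ⟦_⟧ℤ (ℤ.[1+m]⊖[1+n]≡m⊖n m n) ⟩
      ⟦ m ℤ.⊖ n ⟧ℤ                     ≡⟨ ⟦⊖⟧ m n ⟩
      a + - b                         ≡⟨ sym (+-identityˡ _) ⟩
      0r + (a + - b)                  ≡⟨ cong (_+ (a + - b)) (sym (-‿inverseʳ 1r)) ⟩
      (1r + - 1r) + (a + - b)         ≡⟨ interchange 1r (- 1r) a (- b) ⟩
      (1r + a) + (- 1r + - b)         ≡⟨ cong₂ _+_ (sym (1+× m 1r)) (⁻¹-∙-comm 1r b) ⟩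
      suc m ×ℝ 1r + - (1r + b)        ≡⟨ cong (λ z → suc m ×ℝ 1r + - z) (sym (1+× n 1r)) ⟩
      suc m ×ℝ 1r + - (suc n ×ℝ 1r)   ∎
      where
      a b : ℝ
      a = m ×ℝ 1r
      b = n ×ℝ 1r

    +-homo : ∀ i j → ⟦ i ℤ.+ j ⟧ℤ ≡ ⟦ i ⟧ℤ + ⟦ j ⟧ℤ
    +-homo -[1+ m ] -[1+ n ] = begin
      - (suc (suc (m ℕ.+ n)) ×ℝ 1r)         ≡⟨ cong (λ k → - (k ×ℝ 1r)) (sym (ℕ.+-suc (suc m) n)) ⟩
      - ((suc m ℕ.+ suc n) ×ℝ 1r)           ≡⟨ cong -_ (×-homo-+ 1r (suc m) (suc n)) ⟩
      - (suc m ×ℝ 1r + suc n ×ℝ 1r)          ≡⟨ sym (⁻¹-∙-comm _ _) ⟩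
      - (suc m ×ℝ 1r) + - (suc n ×ℝ 1r)      ∎
    +-homo -[1+ m ] (pos n) = trans (⟦⊖⟧ n (suc m)) (+-comm _ _)
    +-homo (pos m) -[1+ n ] = ⟦⊖⟧ m (suc n)
    +-homo (pos m) (pos n) = ×-homo-+ 1r m n

    -‿homo : ∀ i → ⟦ ℤ.- i ⟧ℤ ≡ - ⟦ i ⟧ℤ
    -‿homo -[1+ n ] = sym (-‿involutive _)
    -‿homo (pos zero) = sym -0#≈0#
    -‿homo (pos (suc n)) = refl

  almostCommutativeRing : AlmostCommutativeRing _ _
  almostCommutativeRing = fromCommutativeRing commutativeRing

  ℤ⟶ℝ : ℤ.+-*-rawRing -Raw-AlmostCommutative⟶ almostCommutativeRing
  ℤ⟶ℝ = record
    { ⟦_⟧ = ⟦_⟧ℤ ; +-homo = +-homo ; *-homo = *-homo ; -‿homo = -‿homo ; 0-homo = refl ; 1-homo = refl }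

  ⟦⟧-weaklyDecidable : ∀ i j → Maybe (⟦ i ⟧ℤ ≡ ⟦ j ⟧ℤ)
  ⟦⟧-weaklyDecidable i j with i ℤ.≟ j
  ... | yes i≡j = just (cong ⟦_⟧ℤ i≡j)
  ... | no _ = nothing

  open import Algebra.Solver.Ring ℤ.+-*-rawRing almostCommutativeRing ℤ⟶ℝ ⟦⟧-weaklyDecidable public

module GeometryProperties (R : RealField) where
  open Geometry R
  open RealRingSolver R
  open CommutativeRing commutativeRing
    using (+-assoc; +-identityˡ; +-identityʳ; -‿inverseˡ; -‿inverseʳ; *-assoc; *-comm; *-identityˡ; *-identityʳ;
           zeroˡ; zeroʳ; distribˡ; distribʳ; +-commutativeSemigroup)
  open import Algebra.Properties.CommutativeSemigroup +-commutativeSemigroup using (interchange)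
  open ≡-Reasoning

  _≟_ : (x y : ℝ) → Dec (x ≡ y)
  _≟_ = IsStrictTotalOrder._≟_ isStrictTotalOrder

  *≡0⇒≡0 : ∀ {x y} → ¬ x ≡ 0r → x * y ≡ 0r → y ≡ 0r
  *≡0⇒≡0 {x} {y} x≢0 xy≡0 with inverse x x≢0
  ... | x⁻¹ , xx⁻¹≡1 = begin
    y               ≡⟨ sym (*-identityˡ y) ⟩
    1r * y          ≡⟨ cong (_* y) (sym xx⁻¹≡1) ⟩
    (x * x⁻¹) * y   ≡⟨ solve 3 (λ x x⁻¹ y → (x :* x⁻¹) :* y := x⁻¹ :* (x :* y)) refl x x⁻¹ y ⟩
    x⁻¹ * (x * y)   ≡⟨ cong (x⁻¹ *_) xy≡0 ⟩
    x⁻¹ * 0r        ≡⟨ zeroʳ x⁻¹ ⟩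
    0r              ∎

  *≡0⇒ : ∀ {x y} → x * y ≡ 0r → x ≡ 0r ⊎ y ≡ 0r
  *≡0⇒ {x} xy≡0 with x ≟ 0r
  ... | yes x≡0 = inj₁ x≡0
  ... | no x≢0 = inj₂ (*≡0⇒≡0 x≢0 xy≡0)

  x-y≡0⇒x≡y : ∀ {x y} → x - y ≡ 0r → x ≡ y
  x-y≡0⇒x≡y {x} {y} x-y≡0 = begin
    x              ≡⟨ solve 2 (λ x y → x := (x :- y) :+ y) refl x y ⟩
    (x - y) + y    ≡⟨ cong (_+ y) x-y≡0 ⟩
    0r + y         ≡⟨ +-identityˡ y ⟩
    y              ∎

  u²-u≢0 : ∀ {u} → ¬ u ≡ 0r → ¬ u ≡ 1r → ¬ u * u - u ≡ 0r
  u²-u≢0 {u} u≢0 u≢1 u²-u≡0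
    with *≡0⇒ (trans (solve 1 (λ u → u :* (u :- con (pos 1)) := u :* u :- u) refl u) u²-u≡0)
  ... | inj₁ u≡0 = u≢0 u≡0
  ... | inj₂ u-1≡0 = u≢1 (x-y≡0⇒x≡y u-1≡0)

  proportional-≢0 : ∀ {d₀ d₁ e₀ e₁} → ¬ d₀ ≡ 0r → d₀ * e₁ ≡ d₁ * e₀ →
                    Σ[ t ∈ ℝ ] (e₀ ≡ t * d₀ × e₁ ≡ t * d₁)
  proportional-≢0 {d₀} {d₁} {e₀} {e₁} d₀≢0 det≡0 with inverse d₀ d₀≢0
  ... | k , d₀k≡1 = e₀ * k , (begin
    e₀                ≡⟨ sym (*-identityʳ e₀) ⟩
    e₀ * 1r           ≡⟨ cong (e₀ *_) (sym d₀k≡1) ⟩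
    e₀ * (d₀ * k)     ≡⟨ solve 3 (λ e₀ d₀ k → e₀ :* (d₀ :* k) := e₀ :* k :* d₀) refl e₀ d₀ k ⟩
    e₀ * k * d₀       ∎) , (begin
    e₁                ≡⟨ sym (*-identityʳ e₁) ⟩
    e₁ * 1r           ≡⟨ cong (e₁ *_) (sym d₀k≡1) ⟩
    e₁ * (d₀ * k)     ≡⟨ solve 3 (λ e₁ d₀ k → e₁ :* (d₀ :* k) := d₀ :* e₁ :* k) refl e₁ d₀ k ⟩
    d₀ * e₁ * k       ≡⟨ cong (_* k) det≡0 ⟩
    d₁ * e₀ * k       ≡⟨ solve 3 (λ d₁ e₀ k → d₁ :* e₀ :* k := e₀ :* k :* d₁) refl d₁ e₀ k ⟩
    e₀ * k * d₁       ∎)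

  proportional : ∀ {d₀ d₁ e₀ e₁} → ¬ (d₀ ≡ 0r × d₁ ≡ 0r) → d₀ * e₁ ≡ d₁ * e₀ →
                 Σ[ t ∈ ℝ ] (e₀ ≡ t * d₀ × e₁ ≡ t * d₁)
  proportional {d₀} {d₁} d≢0 det≡0 with d₀ ≟ 0r | d₁ ≟ 0r
  ... | yes d₀≡0 | yes d₁≡0 = ⊥-elim (d≢0 (d₀≡0 , d₁≡0))
  ... | no d₀≢0 | _ = proportional-≢0 d₀≢0 det≡0
  ... | yes _ | no d₁≢0 with proportional-≢0 d₁≢0 (sym det≡0)
  ...   | t , e₁≡ , e₀≡ = t , e₀≡ , e₁≡

  -- Vector operations on ℝⁿ

  ⊕-assoc : ∀ {n} (u v w : Pt n) → (u ⊕ v) ⊕ w ≡ u ⊕ (v ⊕ w)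
  ⊕-assoc = zipWith-assoc +-assoc

  ⊕-identityˡ : ∀ {n} (u : Pt n) → origin ⊕ u ≡ u
  ⊕-identityˡ = zipWith-identityˡ +-identityˡ

  ⊕-identityʳ : ∀ {n} (u : Pt n) → u ⊕ origin ≡ u
  ⊕-identityʳ = zipWith-identityʳ +-identityʳ

  ⊕-interchange : ∀ {n} (u v w z : Pt n) → (u ⊕ v) ⊕ (w ⊕ z) ≡ (u ⊕ w) ⊕ (v ⊕ z)
  ⊕-interchange [] [] [] [] = refl
  ⊕-interchange (u ∷ us) (v ∷ vs) (w ∷ ws) (z ∷ zs) =
    cong₂ _∷_ (interchange u v w z) (⊕-interchange us vs ws zs)

  ⊖-self : ∀ {n} (u : Pt n) → u ⊖ u ≡ origin
  ⊖-self [] = refl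
  ⊖-self (u ∷ us) = cong₂ _∷_ (-‿inverseʳ u) (⊖-self us)

  u⊕[v⊖u]≡v : ∀ {n} (u v : Pt n) → u ⊕ (v ⊖ u) ≡ v
  u⊕[v⊖u]≡v [] [] = refl
  u⊕[v⊖u]≡v (u ∷ us) (v ∷ vs) =
    cong₂ _∷_ (solve 2 (λ u v → u :+ (v :- u) := v) refl u v) (u⊕[v⊖u]≡v us vs)

  ·-distribʳ : ∀ {n} c d (u : Pt n) → (c + d) · u ≡ (c · u) ⊕ (d · u)
  ·-distribʳ c d [] = refl
  ·-distribʳ c d (u ∷ us) = cong₂ _∷_ (distribʳ u c d) (·-distribʳ c d us)

  ·-distribˡ : ∀ {n} c (u v : Pt n) → c · (u ⊕ v) ≡ (c · u) ⊕ (c · v)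
  ·-distribˡ c [] [] = refl
  ·-distribˡ c (u ∷ us) (v ∷ vs) = cong₂ _∷_ (distribˡ c u v) (·-distribˡ c us vs)

  ·-assoc : ∀ {n} c d (u : Pt n) → (c * d) · u ≡ c · (d · u)
  ·-assoc c d [] = refl
  ·-assoc c d (u ∷ us) = cong₂ _∷_ (*-assoc c d u) (·-assoc c d us)

  ·-identityˡ : ∀ {n} (u : Pt n) → 1r · u ≡ u
  ·-identityˡ [] = refl
  ·-identityˡ (u ∷ us) = cong₂ _∷_ (*-identityˡ u) (·-identityˡ us)

  ·-zeroˡ : ∀ {n} (u : Pt n) → 0r · u ≡ origin
  ·-zeroˡ [] = refl
  ·-zeroˡ (u ∷ us) = cong₂ _∷_ (zeroˡ u) (·-zeroˡ us)

  ·-zeroʳ : ∀ {n} c → c · origin {n} ≡ origin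
  ·-zeroʳ {zero} c = refl
  ·-zeroʳ {suc n} c = cong₂ _∷_ (zeroʳ c) (·-zeroʳ c)

  line-at-0 : ∀ {n} (a b : Pt n) → a ⊕ (0r · (b ⊖ a)) ≡ a
  line-at-0 a b = trans (cong (a ⊕_) (·-zeroˡ (b ⊖ a))) (⊕-identityʳ a)

  line-at-1 : ∀ {n} (a b : Pt n) → a ⊕ (1r · (b ⊖ a)) ≡ b
  line-at-1 a b = trans (cong (a ⊕_) (·-identityˡ (b ⊖ a))) (u⊕[v⊖u]≡v a b)

  sumℝ-∷ʳ : ∀ {k} (cs : Vec ℝ k) d → sumℝ (cs ∷ʳ d) ≡ sumℝ cs + d
  sumℝ-∷ʳ [] d = trans (+-identityʳ d) (sym (+-identityˡ d))
  sumℝ-∷ʳ (c ∷ cs) d = trans (cong (c +_) (sumℝ-∷ʳ cs d)) (sym (+-assoc c _ d))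

  sumℝ-⊕ : ∀ {k} (cs ds : Vec ℝ k) → sumℝ (cs ⊕ ds) ≡ sumℝ cs + sumℝ ds
  sumℝ-⊕ [] [] = sym (+-identityˡ 0r)
  sumℝ-⊕ (c ∷ cs) (d ∷ ds) =
    trans (cong ((c + d) +_) (sumℝ-⊕ cs ds)) (interchange c d (sumℝ cs) (sumℝ ds))

  sumℝ-· : ∀ {k} c (cs : Vec ℝ k) → sumℝ (c · cs) ≡ c * sumℝ cs
  sumℝ-· c [] = sym (zeroʳ c)
  sumℝ-· c (d ∷ cs) = trans (cong (c * d +_) (sumℝ-· c cs)) (sym (distribˡ c d (sumℝ cs)))

  lincomb-∷ʳ : ∀ {n k} (cs : Vec ℝ k) d (ps : Vec (Pt n) k) w →
               lincomb (cs ∷ʳ d) (ps ∷ʳ w) ≡ lincomb cs ps ⊕ (d · w)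
  lincomb-∷ʳ [] d [] w = trans (⊕-identityʳ (d · w)) (sym (⊕-identityˡ (d · w)))
  lincomb-∷ʳ (c ∷ cs) d (p ∷ ps) w =
    trans (cong ((c · p) ⊕_) (lincomb-∷ʳ cs d ps w)) (sym (⊕-assoc (c · p) _ (d · w)))

  lincomb-⊕ : ∀ {n k} (cs ds : Vec ℝ k) (ps : Vec (Pt n) k) →
              lincomb (cs ⊕ ds) ps ≡ lincomb cs ps ⊕ lincomb ds ps
  lincomb-⊕ [] [] [] = sym (⊕-identityˡ origin)
  lincomb-⊕ (c ∷ cs) (d ∷ ds) (p ∷ ps) =
    trans (cong₂ _⊕_ (·-distribʳ c d p) (lincomb-⊕ cs ds ps))
          (⊕-interchange (c · p) (d · p) (lincomb cs ps) (lincomb ds ps))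

  lincomb-· : ∀ {n k} c (cs : Vec ℝ k) (ps : Vec (Pt n) k) →
              lincomb (c · cs) ps ≡ c · lincomb cs ps
  lincomb-· c [] [] = sym (·-zeroʳ c)
  lincomb-· c (d ∷ cs) (p ∷ ps) =
    trans (cong₂ _⊕_ (·-assoc c d p) (lincomb-· c cs ps)) (sym (·-distribˡ c (d · p) _))

  dot : ∀ {n} → Pt n → Pt n → ℝ
  dot κ x = sumℝ (zipWith _*_ κ x)

  dot-⊕ : ∀ {n} (κ u v : Pt n) → dot κ (u ⊕ v) ≡ dot κ u + dot κ v
  dot-⊕ [] [] [] = sym (+-identityˡ 0r)
  dot-⊕ (k ∷ κ) (u ∷ us) (v ∷ vs) = begin
    k * (u + v) + dot κ (us ⊕ vs)            ≡⟨ cong (k * (u + v) +_) (dot-⊕ κ us vs) ⟩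
    k * (u + v) + (dot κ us + dot κ vs)      ≡⟨ solve 5 (λ k u v a b → k :* (u :+ v) :+ (a :+ b)
                                                                    := (k :* u :+ a) :+ (k :* v :+ b))
                                                        refl k u v (dot κ us) (dot κ vs) ⟩
    (k * u + dot κ us) + (k * v + dot κ vs)  ∎

  dot-· : ∀ {n} (κ : Pt n) c u → dot κ (c · u) ≡ c * dot κ u
  dot-· [] c [] = sym (zeroʳ c)
  dot-· (k ∷ κ) c (u ∷ us) = begin
    k * (c * u) + dot κ (c · us)
      ≡⟨ cong (k * (c * u) +_) (dot-· κ c us) ⟩
    k * (c * u) + c * dot κ us
      ≡⟨ solve 4 (λ k c u a → k :* (c :* u) :+ c :* a := c :* (k :* u :+ a)) refl k c u (dot κ us) ⟩
    c * (k * u + dot κ us) ∎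

  dot-origin : ∀ {n} (κ : Pt n) → dot κ origin ≡ 0r
  dot-origin [] = refl
  dot-origin (k ∷ κ) = trans (cong₂ _+_ (zeroʳ k) (dot-origin κ)) (+-identityˡ 0r)

  -- Affine spans

  AffIndep3⇒distinct : ∀ {n} {a b c : Pt n} → AffIndep3 a b c → ¬ a ≡ b × ¬ a ≡ c × ¬ b ≡ c
  AffIndep3⇒distinct {a = a} {b} {c} indep = a≢b , a≢c , b≢c
    where
    1≢0 : ¬ 1r ≡ 0r
    1≢0 1≡0 = 0≢1 (sym 1≡0)
    ·self≡origin : ∀ s → s · (a ⊖ a) ≡ origin
    ·self≡origin s = trans (cong (s ·_) (⊖-self a)) (·-zeroʳ s)
    a≢b : ¬ a ≡ b
    a≢b refl = 1≢0 (proj₁ (indep 1r 0r (begin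
      (1r · (a ⊖ a)) ⊕ (0r · (c ⊖ a))   ≡⟨ cong₂ _⊕_ (·self≡origin 1r) (·-zeroˡ (c ⊖ a)) ⟩
      origin ⊕ origin                   ≡⟨ ⊕-identityˡ origin ⟩
      origin                            ∎)))
    a≢c : ¬ a ≡ c
    a≢c refl = 1≢0 (proj₂ (indep 0r 1r (begin
      (0r · (b ⊖ a)) ⊕ (1r · (a ⊖ a))   ≡⟨ cong₂ _⊕_ (·-zeroˡ (b ⊖ a)) (·self≡origin 1r) ⟩
      origin ⊕ origin                   ≡⟨ ⊕-identityˡ origin ⟩
      origin                            ∎)))
    b≢c : ¬ b ≡ c
    b≢c refl = 1≢0 (proj₁ (indep 1r (- 1r) (begin
      (1r · (b ⊖ a)) ⊕ ((- 1r) · (b ⊖ a))   ≡⟨ sym (·-distribʳ 1r (- 1r) (b ⊖ a)) ⟩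
      (1r + - 1r) · (b ⊖ a)                 ≡⟨ cong (_· (b ⊖ a)) (-‿inverseʳ 1r) ⟩
      0r · (b ⊖ a)                          ≡⟨ ·-zeroˡ (b ⊖ a) ⟩
      origin                                ∎)))

  a₀∈F : ∀ {n} (Q : TwoFlat n) → TwoFlat.a₀ Q ∈F Q
  a₀∈F (flat a b c _) = 1r ∷ 0r ∷ 0r ∷ [] ,
    solve 0 (con (pos 1) :+ (con (pos 0) :+ (con (pos 0) :+ con (pos 0))) := con (pos 1)) refl , (sym (begin
      (1r · a) ⊕ ((0r · b) ⊕ ((0r · c) ⊕ origin))
        ≡⟨ cong₂ (λ u v → u ⊕ (v ⊕ ((0r · c) ⊕ origin))) (·-identityˡ a) (·-zeroˡ b) ⟩
      a ⊕ (origin ⊕ ((0r · c) ⊕ origin))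
        ≡⟨ cong (λ v → a ⊕ (origin ⊕ (v ⊕ origin))) (·-zeroˡ c) ⟩
      a ⊕ (origin ⊕ (origin ⊕ origin))
        ≡⟨ cong (a ⊕_) (trans (⊕-identityˡ _) (⊕-identityˡ origin)) ⟩
      a ⊕ origin
        ≡⟨ ⊕-identityʳ a ⟩
      a ∎))

  ∈aff-∷ʳ-trans : ∀ {n k} (ps : Vec (Pt n) k) {v w x} →
                  InAffSpan (ps ∷ʳ w) x → InAffSpan (ps ∷ʳ v) w → InAffSpan (ps ∷ʳ v) x
  ∈aff-∷ʳ-trans ps {v} {w} {x} (cs₁ , sum₁ , x≡) (cs₂ , sum₂ , w≡)
    with initLast cs₁ | initLast cs₂
  ... | cs , d , refl | cs′ , d′ , refl = (cs ⊕ (d · cs′)) ∷ʳ (d * d′) , weights-sum , x≡lincomb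
    where
    weights-sum : sumℝ ((cs ⊕ (d · cs′)) ∷ʳ (d * d′)) ≡ 1r
    weights-sum = begin
      sumℝ ((cs ⊕ (d · cs′)) ∷ʳ (d * d′))
        ≡⟨ sumℝ-∷ʳ (cs ⊕ (d · cs′)) (d * d′) ⟩
      sumℝ (cs ⊕ (d · cs′)) + d * d′
        ≡⟨ cong (_+ d * d′) (trans (sumℝ-⊕ cs _) (cong (sumℝ cs +_) (sumℝ-· d cs′))) ⟩
      (sumℝ cs + d * sumℝ cs′) + d * d′
        ≡⟨ solve 4 (λ a d b d′ → (a :+ d :* b) :+ d :* d′ := a :+ d :* (b :+ d′))
                 refl (sumℝ cs) d (sumℝ cs′) d′ ⟩
      sumℝ cs + d * (sumℝ cs′ + d′)
        ≡⟨ cong (λ z → sumℝ cs + d * z) (trans (sym (sumℝ-∷ʳ cs′ d′)) sum₂) ⟩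
      sumℝ cs + d * 1r
        ≡⟨ cong (sumℝ cs +_) (*-identityʳ d) ⟩
      sumℝ cs + d
        ≡⟨ trans (sym (sumℝ-∷ʳ cs d)) sum₁ ⟩
      1r ∎
    L L′ : Pt _
    L = lincomb cs ps
    L′ = lincomb cs′ ps
    x≡lincomb : x ≡ lincomb ((cs ⊕ (d · cs′)) ∷ʳ (d * d′)) (ps ∷ʳ v)
    x≡lincomb = begin
      x
        ≡⟨ trans x≡ (lincomb-∷ʳ cs d ps w) ⟩
      L ⊕ (d · w)
        ≡⟨ cong (λ z → L ⊕ (d · z)) (trans w≡ (lincomb-∷ʳ cs′ d′ ps v)) ⟩
      L ⊕ (d · (L′ ⊕ (d′ · v)))
        ≡⟨ cong (L ⊕_) (·-distribˡ d L′ _) ⟩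
      L ⊕ ((d · L′) ⊕ (d · (d′ · v)))
        ≡⟨ sym (⊕-assoc L _ _) ⟩
      (L ⊕ (d · L′)) ⊕ (d · (d′ · v))
        ≡⟨ cong₂ _⊕_ (cong (L ⊕_) (sym (lincomb-· d cs′ ps))) (sym (·-assoc d d′ v)) ⟩
      (L ⊕ lincomb (d · cs′) ps) ⊕ ((d * d′) · v)
        ≡⟨ cong (_⊕ ((d * d′) · v)) (sym (lincomb-⊕ cs _ ps)) ⟩
      lincomb (cs ⊕ (d · cs′)) ps ⊕ ((d * d′) · v)
        ≡⟨ sym (lincomb-∷ʳ (cs ⊕ (d · cs′)) (d * d′) ps v) ⟩
      lincomb ((cs ⊕ (d · cs′)) ∷ʳ (d * d′)) (ps ∷ʳ v) ∎

  ∈aff-∷ʳ-drop : ∀ {n k} (ps : Vec (Pt n) k) (cs : Vec ℝ k) {w y} →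
                 sumℝ (cs ∷ʳ 0r) ≡ 1r → y ≡ lincomb (cs ∷ʳ 0r) (ps ∷ʳ w) → InAffSpan ps y
  ∈aff-∷ʳ-drop ps cs {w} {y} sum≡1 y≡ =
    cs , trans (sym (trans (sumℝ-∷ʳ cs 0r) (+-identityʳ _))) sum≡1 , (begin
      y                               ≡⟨ trans y≡ (lincomb-∷ʳ cs 0r ps w) ⟩
      lincomb cs ps ⊕ (0r · w)        ≡⟨ cong (lincomb cs ps ⊕_) (·-zeroˡ w) ⟩
      lincomb cs ps ⊕ origin          ≡⟨ ⊕-identityʳ _ ⟩
      lincomb cs ps                   ∎)

  ∈aff-∷ʳ-exchange : ∀ {n k} (ps : Vec (Pt n) k) (cs : Vec ℝ k) {d w y} → ¬ d ≡ 0r →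
                     sumℝ (cs ∷ʳ d) ≡ 1r → y ≡ lincomb (cs ∷ʳ d) (ps ∷ʳ w) → InAffSpan (ps ∷ʳ y) w
  ∈aff-∷ʳ-exchange ps cs {d} {w} {y} d≢0 sum≡1 y≡ with inverse d d≢0
  ... | k , dk≡1 = ((- k) · cs) ∷ʳ k , weights-sum , w≡lincomb
    where
    weights-sum : sumℝ (((- k) · cs) ∷ʳ k) ≡ 1r
    weights-sum = begin
      sumℝ (((- k) · cs) ∷ʳ k)
        ≡⟨ trans (sumℝ-∷ʳ ((- k) · cs) k) (cong (_+ k) (sumℝ-· (- k) cs)) ⟩
      - k * sumℝ cs + k
        ≡⟨ solve 3 (λ k a d → :- k :* a :+ k := d :* k :+ k :* (con (pos 1) :- (a :+ d))) refl k (sumℝ cs) d ⟩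
      d * k + k * (1r - (sumℝ cs + d))
        ≡⟨ cong (λ z → d * k + k * (1r - z)) (trans (sym (sumℝ-∷ʳ cs d)) sum≡1) ⟩
      d * k + k * (1r - 1r)
        ≡⟨ solve 2 (λ d k → d :* k :+ k :* (con (pos 1) :- con (pos 1)) := d :* k) refl d k ⟩
      d * k
        ≡⟨ dk≡1 ⟩
      1r ∎
    L : Pt _
    L = lincomb cs ps
    w≡lincomb : w ≡ lincomb (((- k) · cs) ∷ʳ k) (ps ∷ʳ y)
    w≡lincomb = begin
      w
        ≡⟨ sym (·-identityˡ w) ⟩
      1r · w
        ≡⟨ cong (_· w) (trans (sym dk≡1) (*-comm d k)) ⟩
      (k * d) · w
        ≡⟨ sym (⊕-identityˡ _) ⟩
      origin ⊕ ((k * d) · w)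
        ≡⟨ cong₂ _⊕_ (sym (trans (cong (_· L) (-‿inverseˡ k)) (·-zeroˡ L))) (·-assoc k d w) ⟩
      ((- k + k) · L) ⊕ (k · (d · w))
        ≡⟨ cong (_⊕ (k · (d · w))) (·-distribʳ (- k) k L) ⟩
      (((- k) · L) ⊕ (k · L)) ⊕ (k · (d · w))
        ≡⟨ ⊕-assoc _ _ _ ⟩
      ((- k) · L) ⊕ ((k · L) ⊕ (k · (d · w)))
        ≡⟨ cong₂ _⊕_ (sym (lincomb-· (- k) cs ps)) (sym (·-distribˡ k L _)) ⟩
      lincomb ((- k) · cs) ps ⊕ (k · (L ⊕ (d · w)))
        ≡⟨ cong (λ z → lincomb ((- k) · cs) ps ⊕ (k · z)) (sym (trans y≡ (lincomb-∷ʳ cs d ps w))) ⟩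
      lincomb ((- k) · cs) ps ⊕ (k · y)
        ≡⟨ sym (lincomb-∷ʳ ((- k) · cs) k ps y) ⟩
      lincomb (((- k) · cs) ∷ʳ k) (ps ∷ʳ y) ∎

  ∈aff-∷ʳ-drop-or-exchange : ∀ {n k} (ps : Vec (Pt n) k) {w y} →
                             InAffSpan (ps ∷ʳ w) y → InAffSpan ps y ⊎ InAffSpan (ps ∷ʳ y) w
  ∈aff-∷ʳ-drop-or-exchange ps (cs′ , sum≡1 , y≡) with initLast cs′
  ... | cs , d , refl with d ≟ 0r
  ...   | yes refl = inj₁ (∈aff-∷ʳ-drop ps cs sum≡1 y≡)
  ...   | no d≢0 = inj₂ (∈aff-∷ʳ-exchange ps cs d≢0 sum≡1 y≡)

  lincomb-insert-0 : ∀ {n k m} (xs : Vec (Pt n) k) (ys : Vec (Pt n) m) z (cs : Vec ℝ (k ℕ.+ m)) →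
                     Σ[ cs′ ∈ Vec ℝ (k ℕ.+ suc m) ]
                       (sumℝ cs′ ≡ sumℝ cs × lincomb cs′ (xs ++ z ∷ ys) ≡ lincomb cs (xs ++ ys))
  lincomb-insert-0 [] ys z cs =
    0r ∷ cs , +-identityˡ _ , trans (cong (_⊕ lincomb cs ys) (·-zeroˡ z)) (⊕-identityˡ _)
  lincomb-insert-0 (p ∷ xs) ys z (c ∷ cs) =
    let (cs′ , sum≡ , lincomb≡) = lincomb-insert-0 xs ys z cs
    in c ∷ cs′ , cong (c +_) sum≡ , cong ((c · p) ⊕_) lincomb≡

  ∈aff-insert : ∀ {n k m} (xs : Vec (Pt n) k) {ys : Vec (Pt n) m} z {x} →
                InAffSpan (xs ++ ys) x → InAffSpan (xs ++ z ∷ ys) x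
  ∈aff-insert xs {ys} z (cs , sum≡1 , x≡) =
    let (cs′ , sum≡ , lincomb≡) = lincomb-insert-0 xs ys z cs
    in cs′ , trans sum≡ sum≡1 , trans x≡ (sym lincomb≡)

  affine-vanishes-on-span : ∀ {n k} (c₀ : ℝ) (κ : Pt n) {ps : Vec (Pt n) k} {x} →
                            All (λ p → c₀ + dot κ p ≡ 0r) ps → InAffSpan ps x → c₀ + dot κ x ≡ 0r
  affine-vanishes-on-span c₀ κ {ps} {x} vanish (cs , sum≡1 , x≡) = begin
    c₀ + dot κ x                         ≡⟨ cong (_+ dot κ x) (sym (*-identityʳ c₀)) ⟩
    c₀ * 1r + dot κ x                    ≡⟨ cong₂ (λ s y → c₀ * s + dot κ y) (sym sum≡1) x≡ ⟩
    c₀ * sumℝ cs + dot κ (lincomb cs ps)  ≡⟨ weighted vanish cs ⟩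
    0r                                   ∎
    where
    weighted : ∀ {k} {ps : Vec (Pt _) k} → All (λ p → c₀ + dot κ p ≡ 0r) ps →
               ∀ cs → c₀ * sumℝ cs + dot κ (lincomb cs ps) ≡ 0r
    weighted [] [] = trans (cong₂ _+_ (zeroʳ c₀) (dot-origin κ)) (+-identityˡ 0r)
    weighted {ps = p ∷ ps} (p-vanishes ∷ vanish) (c ∷ cs) = begin
      c₀ * (c + sumℝ cs) + dot κ ((c · p) ⊕ lincomb cs ps)
        ≡⟨ cong (c₀ * (c + sumℝ cs) +_)
                (trans (dot-⊕ κ (c · p) (lincomb cs ps)) (cong (_+ dot κ (lincomb cs ps)) (dot-· κ c p))) ⟩
      c₀ * (c + sumℝ cs) + (c * dot κ p + dot κ (lincomb cs ps))
        ≡⟨ solve 5 (λ c₀ c s a b → c₀ :* (c :+ s) :+ (c :* a :+ b) := c :* (c₀ :+ a) :+ (c₀ :* s :+ b))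
                 refl c₀ c (sumℝ cs) (dot κ p) (dot κ (lincomb cs ps)) ⟩
      c * (c₀ + dot κ p) + (c₀ * sumℝ cs + dot κ (lincomb cs ps))
        ≡⟨ cong₂ (λ a b → c * a + b) p-vanishes (weighted vanish cs) ⟩
      c * 0r + 0r
        ≡⟨ trans (+-identityʳ _) (zeroʳ c) ⟩
      0r ∎

  -- Lines in the plane

  cross : Pt 2 → Pt 2 → Pt 2 → ℝ
  cross (a₀ ∷ a₁ ∷ []) (b₀ ∷ b₁ ∷ []) (x₀ ∷ x₁ ∷ []) =
    (b₀ - a₀) * (x₁ - a₁) - (b₁ - a₁) * (x₀ - a₀)

  cross-at-start : ∀ a b → cross a b a ≡ 0r
  cross-at-start (a₀ ∷ a₁ ∷ []) (b₀ ∷ b₁ ∷ []) =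
    solve 4 (λ a₀ a₁ b₀ b₁ → (b₀ :- a₀) :* (a₁ :- a₁) :- (b₁ :- a₁) :* (a₀ :- a₀) := con (pos 0))
            refl a₀ a₁ b₀ b₁

  cross-at-end : ∀ a b → cross a b b ≡ 0r
  cross-at-end (a₀ ∷ a₁ ∷ []) (b₀ ∷ b₁ ∷ []) =
    solve 4 (λ a₀ a₁ b₀ b₁ → (b₀ :- a₀) :* (b₁ :- a₁) :- (b₁ :- a₁) :* (b₀ :- a₀) := con (pos 0))
            refl a₀ a₁ b₀ b₁

  OnLine⇒cross≡0 : ∀ {a b x} → OnLine a b x → cross a b x ≡ 0r
  OnLine⇒cross≡0 {a₀ ∷ a₁ ∷ []} {b₀ ∷ b₁ ∷ []} (t , refl) =
    solve 5 (λ a₀ a₁ b₀ b₁ t → (b₀ :- a₀) :* ((a₁ :+ t :* (b₁ :- a₁)) :- a₁)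
                               :- (b₁ :- a₁) :* ((a₀ :+ t :* (b₀ :- a₀)) :- a₀)
                             := con (pos 0))
            refl a₀ a₁ b₀ b₁ t

  cross≡0⇒OnLine : ∀ {a b x} → ¬ a ≡ b → cross a b x ≡ 0r → OnLine a b x
  cross≡0⇒OnLine {a₀ ∷ a₁ ∷ []} {b₀ ∷ b₁ ∷ []} {x₀ ∷ x₁ ∷ []} a≢b cross≡0
    with proportional direction≢0 (x-y≡0⇒x≡y cross≡0)
    where
    direction≢0 : ¬ (b₀ - a₀ ≡ 0r × b₁ - a₁ ≡ 0r)
    direction≢0 (d₀≡0 , d₁≡0) =
      a≢b (cong₂ _∷_ (sym (x-y≡0⇒x≡y d₀≡0)) (cong₂ _∷_ (sym (x-y≡0⇒x≡y d₁≡0)) refl))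
  ... | t , e₀≡ , e₁≡ = t , cong₂ _∷_ (shift e₀≡) (cong₂ _∷_ (shift e₁≡) refl)
    where
    shift : ∀ {x a d} → x - a ≡ t * d → x ≡ a + t * d
    shift {x} {a} x-a≡ = trans (solve 2 (λ x a → x := a :+ (x :- a)) refl x a) (cong (a +_) x-a≡)

  OnLine? : ∀ {a b} → ¬ a ≡ b → ∀ x → Dec (OnLine a b x)
  OnLine? {a} {b} a≢b x with cross a b x ≟ 0r
  ... | yes cross≡0 = yes (cross≡0⇒OnLine a≢b cross≡0)
  ... | no cross≢0 = no (λ x∈ab → cross≢0 (OnLine⇒cross≡0 x∈ab))

  two-lines-meet-once : ∀ {q r s x} → cross r s x ≡ 0r → cross q s x ≡ 0r → ¬ cross q r s ≡ 0r →
                        x ≡ s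
  two-lines-meet-once {q@(q₀ ∷ q₁ ∷ [])} {r@(r₀ ∷ r₁ ∷ [])} {s@(s₀ ∷ s₁ ∷ [])} {x@(x₀ ∷ x₁ ∷ [])}
                      x∈rs x∈qs qrs≢0 =
    cong₂ _∷_ (coordinate x₀-identity) (cong₂ _∷_ (coordinate x₁-identity) refl)
    where
    coordinate : ∀ {xᵢ sᵢ rᵢ qᵢ} →
                 cross q r s * (xᵢ - sᵢ) ≡ cross q s x * (sᵢ - rᵢ) - cross r s x * (sᵢ - qᵢ) → xᵢ ≡ sᵢ
    coordinate {xᵢ} {sᵢ} {rᵢ} {qᵢ} identity = x-y≡0⇒x≡y (*≡0⇒≡0 qrs≢0 (begin
      cross q r s * (xᵢ - sᵢ)
        ≡⟨ identity ⟩
      cross q s x * (sᵢ - rᵢ) - cross r s x * (sᵢ - qᵢ)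
        ≡⟨ cong₂ (λ u v → u * (sᵢ - rᵢ) - v * (sᵢ - qᵢ)) x∈qs x∈rs ⟩
      0r * (sᵢ - rᵢ) - 0r * (sᵢ - qᵢ)
        ≡⟨ solve 2 (λ a b → con (pos 0) :* a :- con (pos 0) :* b := con (pos 0)) refl (sᵢ - rᵢ) (sᵢ - qᵢ) ⟩
      0r ∎))
    x₀-identity : cross q r s * (x₀ - s₀) ≡ cross q s x * (s₀ - r₀) - cross r s x * (s₀ - q₀)
    x₀-identity = solve 8 (λ q₀ q₁ r₀ r₁ s₀ s₁ x₀ x₁ →
      ((r₀ :- q₀) :* (s₁ :- q₁) :- (r₁ :- q₁) :* (s₀ :- q₀)) :* (x₀ :- s₀)
      := ((s₀ :- q₀) :* (x₁ :- q₁) :- (s₁ :- q₁) :* (x₀ :- q₀)) :* (s₀ :- r₀)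
         :- ((s₀ :- r₀) :* (x₁ :- r₁) :- (s₁ :- r₁) :* (x₀ :- r₀)) :* (s₀ :- q₀))
      refl q₀ q₁ r₀ r₁ s₀ s₁ x₀ x₁
    x₁-identity : cross q r s * (x₁ - s₁) ≡ cross q s x * (s₁ - r₁) - cross r s x * (s₁ - q₁)
    x₁-identity = solve 8 (λ q₀ q₁ r₀ r₁ s₀ s₁ x₀ x₁ →
      ((r₀ :- q₀) :* (s₁ :- q₁) :- (r₁ :- q₁) :* (s₀ :- q₀)) :* (x₁ :- s₁)
      := ((s₀ :- q₀) :* (x₁ :- q₁) :- (s₁ :- q₁) :* (x₀ :- q₀)) :* (s₁ :- r₁)
         :- ((s₀ :- r₀) :* (x₁ :- r₁) :- (s₁ :- r₁) :* (x₀ :- r₀)) :* (s₁ :- q₁))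
      refl q₀ q₁ r₀ r₁ s₀ s₁ x₀ x₁

  -- Quadratic functions and the Veronese map

  IsAffine : (Pt 2 → ℝ) → Set
  IsAffine h = Σ[ a₀ ∈ ℝ ] Σ[ a ∈ Pt 2 ] ∀ x → h x ≡ a₀ + dot a x

  IsQuadratic : (Pt 2 → ℝ) → Set
  IsQuadratic g = Σ[ c₀ ∈ ℝ ] Σ[ κ ∈ Pt 5 ] ∀ x → g x ≡ c₀ + dot κ (Veronese x)

  cross-affine : ∀ a b → IsAffine (cross a b)
  cross-affine (a₀ ∷ a₁ ∷ []) (b₀ ∷ b₁ ∷ []) =
    (b₁ - a₁) * a₀ - (b₀ - a₀) * a₁ , - (b₁ - a₁) ∷ (b₀ - a₀) ∷ [] , λ where
      (x₀ ∷ x₁ ∷ []) → solve 6 (λ a₀ a₁ b₀ b₁ x₀ x₁ →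
        (b₀ :- a₀) :* (x₁ :- a₁) :- (b₁ :- a₁) :* (x₀ :- a₀)
        := ((b₁ :- a₁) :* a₀ :- (b₀ :- a₀) :* a₁)
           :+ (:- (b₁ :- a₁) :* x₀ :+ ((b₀ :- a₀) :* x₁ :+ con (pos 0))))
        refl a₀ a₁ b₀ b₁ x₀ x₁

  affine*affine-quadratic : ∀ {g h} → IsAffine g → IsAffine h → IsQuadratic (λ x → g x * h x)
  affine*affine-quadratic {g} {h} (a₀ , a₁ ∷ a₂ ∷ [] , g≡) (b₀ , b₁ ∷ b₂ ∷ [] , h≡) =
    c₀ , κ , gh≡
    where
    c₀ : ℝ
    c₀ = a₀ * b₀
    κ : Pt 5
    κ = (a₀ * b₁ + a₁ * b₀) ∷ (a₀ * b₂ + a₂ * b₀) ∷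
        a₁ * b₁ ∷ (a₁ * b₂ + a₂ * b₁) ∷ a₂ * b₂ ∷ []
    gh≡ : ∀ x → g x * h x ≡ c₀ + dot κ (Veronese x)
    gh≡ x@(x₀ ∷ x₁ ∷ []) = trans (cong₂ _*_ (g≡ x) (h≡ x)) (solve 8 (λ a₀ a₁ a₂ b₀ b₁ b₂ x₀ x₁ →
      (a₀ :+ (a₁ :* x₀ :+ (a₂ :* x₁ :+ con (pos 0)))) :* (b₀ :+ (b₁ :* x₀ :+ (b₂ :* x₁ :+ con (pos 0))))
      := a₀ :* b₀ :+ ((a₀ :* b₁ :+ a₁ :* b₀) :* x₀ :+ ((a₀ :* b₂ :+ a₂ :* b₀) :* x₁
         :+ (a₁ :* b₁ :* (x₀ :* x₀) :+ ((a₁ :* b₂ :+ a₂ :* b₁) :* (x₀ :* x₁)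
         :+ (a₂ :* b₂ :* (x₁ :* x₁) :+ con (pos 0)))))))
      refl a₀ a₁ a₂ b₀ b₁ b₂ x₀ x₁)

  quadratic-vanishes-on-span : ∀ {g k} → IsQuadratic g → {ps : Vec (Pt 2) k} {x : Pt 2} →
                               All (λ p → g p ≡ 0r) ps → InAffSpan (map Veronese ps) (Veronese x) → g x ≡ 0r
  quadratic-vanishes-on-span (c₀ , κ , g≡) {x = x} vanish span =
    trans (g≡ x) (affine-vanishes-on-span c₀ κ (map⁺ (All.map (λ {p} → trans (sym (g≡ p))) vanish)) span)

  line-pair-through-span : ∀ {k} a b c d {ps : Vec (Pt 2) k} {x} →
                           All (λ y → cross a b y ≡ 0r ⊎ cross c d y ≡ 0r) ps →
                           InAffSpan (map Veronese ps) (Veronese x) → cross a b x ≡ 0r ⊎ cross c d x ≡ 0r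
  line-pair-through-span a b c d on-lines span =
    *≡0⇒ (quadratic-vanishes-on-span (affine*affine-quadratic (cross-affine a b) (cross-affine c d))
                                     (All.map product≡0 on-lines) span)
    where
    product≡0 : ∀ {u v} → u ≡ 0r ⊎ v ≡ 0r → u * v ≡ 0r
    product≡0 {v = v} (inj₁ refl) = zeroˡ v
    product≡0 {u = u} (inj₂ refl) = zeroʳ u

  Veronese-span-outside-Δ : ∀ {p q r s x} → ¬ p ≡ q × ¬ p ≡ r × ¬ q ≡ r →
                            ¬ InΔ p q r s → ¬ InΔ p q r x →
                            InAffSpan (map Veronese (p ∷ q ∷ r ∷ s ∷ [])) (Veronese x) → x ≡ s
  Veronese-span-outside-Δ {p} {q} {r} {s} {x} (p≢q , p≢r , q≢r) s∉Δ x∉Δ span =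
    two-lines-meet-once {q} {r} x∈rs x∈qs qrs≢0
    where
    x∈rs : cross r s x ≡ 0r
    x∈rs with line-pair-through-span p q r s
                (inj₁ (cross-at-start p q) ∷ inj₁ (cross-at-end p q) ∷
                 inj₂ (cross-at-start r s) ∷ inj₂ (cross-at-end r s) ∷ []) span
    ... | inj₁ x∈pq = ⊥-elim (x∉Δ (inj₁ (cross≡0⇒OnLine p≢q x∈pq)))
    ... | inj₂ x∈rs = x∈rs
    x∈qs : cross q s x ≡ 0r
    x∈qs with line-pair-through-span p r q s
                (inj₁ (cross-at-start p r) ∷ inj₂ (cross-at-start q s) ∷
                 inj₁ (cross-at-end p r) ∷ inj₂ (cross-at-end q s) ∷ []) span
    ... | inj₁ x∈pr = ⊥-elim (x∉Δ (inj₂ (inj₁ (cross≡0⇒OnLine p≢r x∈pr))))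
    ... | inj₂ x∈qs = x∈qs
    qrs≢0 : ¬ cross q r s ≡ 0r
    qrs≢0 s∈qr = s∉Δ (inj₂ (inj₂ (cross≡0⇒OnLine q≢r s∈qr)))

  Veronese-line : ∀ a b {t u} → ¬ u ≡ 0r → ¬ u ≡ 1r →
                  InAffSpan (Veronese a ∷ Veronese b ∷ Veronese (a ⊕ (u · (b ⊖ a))) ∷ [])
                            (Veronese (a ⊕ (t · (b ⊖ a))))
  Veronese-line (a₀ ∷ a₁ ∷ []) (b₀ ∷ b₁ ∷ []) {t} {u} u≢0 u≢1
    with inverse (u * u - u) (u²-u≢0 u≢0 u≢1)
  ... | k , k-inverse =
    w₀ ∷ w₁ ∷ wᵤ ∷ [] ,
    solve 3 (λ t u k → W₀ t u k :+ (W₁ t u k :+ (Wᵤ t u k :+ con (pos 0))) := con (pos 1)) refl t u k ,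
    cong₂ _∷_ (linear a₀ b₀) (cong₂ _∷_ (linear a₁ b₁)
      (cong₂ _∷_ (quadratic a₀ a₀ b₀ b₀) (cong₂ _∷_ (quadratic a₀ a₁ b₀ b₁)
        (cong₂ _∷_ (quadratic a₁ a₁ b₁ b₁) refl))))
    where
    -- the Lagrange weights of the nodes 0, 1 and u at t, where k = 1/(u² − u)
    Wᵤ W₁ W₀ : ∀ {m} → Polynomial m → Polynomial m → Polynomial m → Polynomial m
    Wᵤ t u k = (t :* t :- t) :* k
    W₁ t u k = t :- Wᵤ t u k :* u
    W₀ t u k = (con (pos 1) :- W₁ t u k) :- Wᵤ t u k
    w₀ w₁ wᵤ : ℝ
    wᵤ = (t * t - t) * k
    w₁ = t - wᵤ * u
    w₀ = (1r - w₁) - wᵤ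
    linear : ∀ aᵢ bᵢ →
             aᵢ + t * (bᵢ - aᵢ) ≡ w₀ * aᵢ + (w₁ * bᵢ + (wᵤ * (aᵢ + u * (bᵢ - aᵢ)) + 0r))
    linear aᵢ bᵢ = solve 5 (λ aᵢ bᵢ t u k →
      aᵢ :+ t :* (bᵢ :- aᵢ)
      := W₀ t u k :* aᵢ :+ (W₁ t u k :* bᵢ :+ (Wᵤ t u k :* (aᵢ :+ u :* (bᵢ :- aᵢ)) :+ con (pos 0))))
      refl aᵢ bᵢ t u k
    quadratic : ∀ aᵢ aⱼ bᵢ bⱼ → (aᵢ + t * (bᵢ - aᵢ)) * (aⱼ + t * (bⱼ - aⱼ)) ≡
                w₀ * (aᵢ * aⱼ) + (w₁ * (bᵢ * bⱼ)
                  + (wᵤ * ((aᵢ + u * (bᵢ - aᵢ)) * (aⱼ + u * (bⱼ - aⱼ))) + 0r))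
    quadratic aᵢ aⱼ bᵢ bⱼ = begin
      (aᵢ + t * (bᵢ - aᵢ)) * (aⱼ + t * (bⱼ - aⱼ))
        ≡⟨ solve 7 (λ aᵢ aⱼ bᵢ bⱼ t u k →
             (aᵢ :+ t :* (bᵢ :- aᵢ)) :* (aⱼ :+ t :* (bⱼ :- aⱼ))
             := W₀ t u k :* (aᵢ :* aⱼ) :+ (W₁ t u k :* (bᵢ :* bⱼ)
                  :+ (Wᵤ t u k :* ((aᵢ :+ u :* (bᵢ :- aᵢ)) :* (aⱼ :+ u :* (bⱼ :- aⱼ))) :+ con (pos 0)))
                :+ ((bᵢ :- aᵢ) :* (bⱼ :- aⱼ) :* (t :* t :- t)) :* (con (pos 1) :- (u :* u :- u) :* k))
             refl aᵢ aⱼ bᵢ bⱼ t u k ⟩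
      rhs + e * (1r - (u * u - u) * k)
        ≡⟨ cong (λ z → rhs + e * (1r - z)) k-inverse ⟩
      rhs + e * (1r - 1r)
        ≡⟨ solve 2 (λ rhs e → rhs :+ e :* (con (pos 1) :- con (pos 1)) := rhs) refl rhs e ⟩
      rhs ∎
      where
      rhs e : ℝ
      rhs = w₀ * (aᵢ * aⱼ) + (w₁ * (bᵢ * bⱼ)
              + (wᵤ * ((aᵢ + u * (bᵢ - aᵢ)) * (aⱼ + u * (bⱼ - aⱼ))) + 0r))
      e = (bᵢ - aᵢ) * (bⱼ - aⱼ) * (t * t - t)

  Veronese-collinear : ∀ {a b s₀ s} → OnLine a b s₀ → OnLine a b s → ¬ s₀ ≡ a → ¬ s₀ ≡ b →
                       InAffSpan (Veronese a ∷ Veronese b ∷ Veronese s₀ ∷ []) (Veronese s)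
  Veronese-collinear {a} {b} (u , refl) (t , refl) s₀≢a s₀≢b =
    Veronese-line a b (λ { refl → s₀≢a (line-at-0 a b) }) (λ { refl → s₀≢b (line-at-1 a b) })

  -- Projection from P to Q

  module Projection (p q r : Pt 2) (Q : TwoFlat 5) where

    P : Vec (Pt 5) 3
    P = Veronese p ∷ Veronese q ∷ Veronese r ∷ []

    meet-respects-span : ∀ {x x′} (m : UniqueMeet p q r Q x) (m′ : UniqueMeet p q r Q x′) →
                         InSpanPx p q r x′ x → proj₁ m ≡ proj₁ m′
    meet-respects-span (y , (y∈Q , y∈Px) , _) (_ , _ , unique′) x∈Px′ =
      unique′ y y∈Q (∈aff-∷ʳ-trans P y∈Px x∈Px′)

    equal-meets⇒∈span : (∀ z → InP p q r z → ¬ z ∈F Q) → ∀ {x x′}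
                        (m : UniqueMeet p q r Q x) (m′ : UniqueMeet p q r Q x′) →
                        proj₁ m ≡ proj₁ m′ → InSpanPx p q r x x′
    equal-meets⇒∈span P∩Q≡∅ (y , (_ , y∈Px) , _) (y , (y∈Q , y∈Px′) , _) refl
      with ∈aff-∷ʳ-drop-or-exchange P y∈Px′
    ... | inj₁ y∈P = ⊥-elim (P∩Q≡∅ y y∈P y∈Q)
    ... | inj₂ x′∈Py = ∈aff-∷ʳ-trans P x′∈Py y∈Px

    meet-injective-off-Δ : AffIndep3 p q r → (∀ z → InP p q r z → ¬ z ∈F Q) → ∀ {s s′}
                           (m : UniqueMeet p q r Q (Veronese s)) (m′ : UniqueMeet p q r Q (Veronese s′)) →
                           ¬ InΔ p q r s → ¬ InΔ p q r s′ →
                           proj₁ m ≡ proj₁ m′ → Veronese s ≡ Veronese s′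
    meet-injective-off-Δ indep P∩Q≡∅ m m′ s∉Δ s′∉Δ π≡π′ =
      cong Veronese (sym (Veronese-span-outside-Δ (AffIndep3⇒distinct indep) s∉Δ s′∉Δ
                                                  (equal-meets⇒∈span P∩Q≡∅ m m′ π≡π′)))

    meet-constant-on : (S : List (Pt 2)) (meet : ∀ s → s ∈ S → UniqueMeet p q r Q (Veronese s))
                       {ℓ : Pt 2 → Set} → Decidable ℓ →
                       (∀ {s₀ s} → s₀ ∈ S → ℓ s₀ → ℓ s → InSpanPx p q r (Veronese s₀) (Veronese s)) →
                       ∃[ α ] (α ∈F Q × (∀ s (m : s ∈ S) → ℓ s → proj₁ (meet s m) ≡ α))
    meet-constant-on S meet ℓ? ℓ-spanned with any? ℓ? S
    ... | yes some∈ℓ with find some∈ℓ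
    ...   | s₀ , m₀ , s₀∈ℓ =
      proj₁ (meet s₀ m₀) , proj₁ (proj₁ (proj₂ (meet s₀ m₀))) ,
      λ s m s∈ℓ → meet-respects-span (meet s m) (meet s₀ m₀) (ℓ-spanned m₀ s₀∈ℓ s∈ℓ)
    meet-constant-on S meet ℓ? ℓ-spanned | no none∈ℓ =
      TwoFlat.a₀ Q , a₀∈F Q , λ s m s∈ℓ → ⊥-elim (none∈ℓ (lose m s∈ℓ))

lemma4p3 : (R : RealField) → let open Geometry R in
    (p q r : Pt 2) → AffIndep3 p q r →
    (S : List (Pt 2)) →
    (∀ s → s ∈ S → ¬ (s ≡ p) × ¬ (s ≡ q) × ¬ (s ≡ r)) →
    (Q : TwoFlat 5) →
    (∀ z → InP p q r z → ¬ (z ∈F Q)) →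
    (meet : ∀ s → s ∈ S → UniqueMeet p q r Q (Veronese s)) →
    ((∀ s s′ (m : s ∈ S) (m′ : s′ ∈ S) → ¬ InΔ p q r s → ¬ InΔ p q r s′ →
        proj₁ (meet s m) ≡ proj₁ (meet s′ m′) → Veronese s ≡ Veronese s′) ×
     (∃[ α₁ ] ∃[ α₂ ] ∃[ α₃ ] ((α₁ ∈F Q) × (α₂ ∈F Q) × (α₃ ∈F Q) ×
        (∀ s (m : s ∈ S) → OnLine p q s → proj₁ (meet s m) ≡ α₁) ×
        (∀ s (m : s ∈ S) → OnLine p r s → proj₁ (meet s m) ≡ α₂) ×
        (∀ s (m : s ∈ S) → OnLine q r s → proj₁ (meet s m) ≡ α₃))))
lemma4p3 R p q r indep S S∌pqr Q P∩Q≡∅ meet =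
  let (α₁ , α₁∈Q , on-pq) = meet-constant-on S meet (OnLine? p≢q) λ m₀ s₀∈pq s∈pq →
        ∈aff-insert (Veronese p ∷ Veronese q ∷ []) (Veronese r)
                    (Veronese-collinear s₀∈pq s∈pq (s≢p m₀) (s≢q m₀))
      (α₂ , α₂∈Q , on-pr) = meet-constant-on S meet (OnLine? p≢r) λ m₀ s₀∈pr s∈pr →
        ∈aff-insert (Veronese p ∷ []) (Veronese q)
                    (Veronese-collinear s₀∈pr s∈pr (s≢p m₀) (s≢r m₀))
      (α₃ , α₃∈Q , on-qr) = meet-constant-on S meet (OnLine? q≢r) λ m₀ s₀∈qr s∈qr →
        ∈aff-insert [] (Veronese p)
                    (Veronese-collinear s₀∈qr s∈qr (s≢q m₀) (s≢r m₀))
  in (λ s s′ m m′ → meet-injective-off-Δ indep P∩Q≡∅ (meet s m) (meet s′ m′)) ,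
     α₁ , α₂ , α₃ , α₁∈Q , α₂∈Q , α₃∈Q , on-pq , on-pr , on-qr
  where
  open Geometry R
  open GeometryProperties R
  open Projection p q r Q
  p≢q : ¬ p ≡ q
  p≢q = proj₁ (AffIndep3⇒distinct indep)
  p≢r : ¬ p ≡ r
  p≢r = proj₁ (proj₂ (AffIndep3⇒distinct indep))
  q≢r : ¬ q ≡ r
  q≢r = proj₂ (proj₂ (AffIndep3⇒distinct indep))
  s≢p : ∀ {s} → s ∈ S → ¬ s ≡ p
  s≢p {s} m = proj₁ (S∌pqr s m)
  s≢q : ∀ {s} → s ∈ S → ¬ s ≡ q
  s≢q {s} m = proj₁ (proj₂ (S∌pqr s m))
  s≢r : ∀ {s} → s ∈ S → ¬ s ≡ r
  s≢r {s} m = proj₂ (proj₂ (S∌pqr s m))
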